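{- Let $1/n\ll c\ll\xi$. Let $S$ be the path with vertices, in order, $Y_3,X_2,Y_1,X_0,Y_0,X_1,Y_2,X_3$ (edges $Y_3X_2$, $X_2Y_1$, $Y_1X_0$, $X_0Y_0$, $Y_0X_1$, $X_1Y_2$, $Y_2X_3$). Let $T$ be an $n$-vertex tree with $\Delta(T)\le cn$. Then there is a graph homomorphism $\phi:T\to S$ such that every component of $T-\phi^{ -1}(\{X_0,Y_0\})$ has at most $\xi n$ vertices and $|\phi^{ -1}(\{X_0,Y_0,X_1,Y_1\})|\le\xi n$.
   Context: Hierarchy notation "$1/n\ll c\ll\xi$": $c$ is sufficiently small in terms of $\xi$ and $n$ sufficiently large in terms of $c$. A graph homomorphism $\phi:H_1\to H_2$ is a map $V(H_1)\to V(H_2)$ with $\phi(u)\phi(v)\in E(H_2)$ whenever $uv\in E(H_1)$.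
   Formalization: The parameter ξ ranges over the positive rationals, and the constant c is also taken in the positive rationals. -}

module Defs where

open import Data.Nat using (ℕ; suc)
open import Data.Bool using (Bool; true; false; T)
open import Data.Fin using (Fin)
open import Data.List using (List; []; _∷_; length; filter; allFin; last)
open import Data.List.Relation.Unary.Unique.Propositional using (Unique)
open import Data.List.Relation.Unary.Linked using (Linked)
open import Data.List.Relation.Unary.All using (All)
open import Data.Maybe using (Maybe; just; nothing)
open import Data.Product using (Σ; _×_; _,_)
open import Data.Unit using (⊤)
open import Data.Empty using (⊥)
open import Data.Integer using (+_)
open import Data.Rational using (ℚ; _/_)
open import Relation.Binary.PropositionalEquality using (_≡_)
open import Relation.Nullary using (¬_)

ℕ→ℚ : ℕ → ℚ
ℕ→ℚ k = (+ k) / 1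

record Graph (n : ℕ) : Set where
  field
    Adj   : Fin n → Fin n → Bool
    sym   : ∀ u v → Adj u v ≡ Adj v u
    irrefl : ∀ u → Adj u u ≡ false
open Graph public

deg : ∀ {n} → Graph n → Fin n → ℕ
deg G u = length (filter (λ v → T? (Adj G u v)) (allFin _))
  where
  open import Relation.Nullary.Decidable using (Dec)
  T? : (b : Bool) → Dec (T b)
  T? = Data.Bool.T?

-- u and v are joined by a walk all of whose vertices satisfy P
-- (i.e. u, v lie in the same component of the induced subgraph G[P])
data ConnIn {n} (G : Graph n) (P : Fin n → Set) (u : Fin n) : Fin n → Set where
  here : P u → ConnIn G P u u
  step : ∀ {v w} → ConnIn G P u v → Adj G v w ≡ true → P w → ConnIn G P u w

Connected : ∀ {n} → Graph n → Set
Connected G = ∀ u v → ConnIn G (λ _ → ⊤) u v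

IsCycle : ∀ {n} → Graph n → List (Fin n) → Set
IsCycle G [] = ⊥
IsCycle G (_ ∷ []) = ⊥
IsCycle G (_ ∷ _ ∷ []) = ⊥
IsCycle G vs@(v₀ ∷ v₁ ∷ v₂ ∷ rest) =
  Unique vs × Linked (λ a b → Adj G a b ≡ true) vs × LastAdj (v₂ ∷ rest)
  where
  LastAdj : List (Fin _) → Set
  LastAdj [] = ⊥
  LastAdj (x ∷ []) = Adj G x v₀ ≡ true
  LastAdj (_ ∷ y ∷ ys) = LastAdj (y ∷ ys)

Acyclic : ∀ {n} → Graph n → Set
Acyclic G = ∀ vs → ¬ IsCycle G vs

IsTree : ∀ {n} → Graph n → Set
IsTree G = Connected G × Acyclic G

data SV : Set where
  Y3 X2 Y1 X0 Y0 X1 Y2 X3 : SV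

SAdj : SV → SV → Bool
SAdj Y3 X2 = true
SAdj X2 Y3 = true
SAdj X2 Y1 = true
SAdj Y1 X2 = true
SAdj Y1 X0 = true
SAdj X0 Y1 = true
SAdj X0 Y0 = true
SAdj Y0 X0 = true
SAdj Y0 X1 = true
SAdj X1 Y0 = true
SAdj X1 Y2 = true
SAdj Y2 X1 = true
SAdj Y2 X3 = true
SAdj X3 Y2 = true
SAdj _ _ = false

IsHom : ∀ {n} → Graph n → (Fin n → SV) → Set
IsHom G φ = ∀ u v → Adj G u v ≡ true → SAdj (φ u) (φ v) ≡ true

inX0Y0 : SV → Bool
inX0Y0 X0 = true
inX0Y0 Y0 = true
inX0Y0 _  = false

inCentral : SV → Bool
inCentral X0 = true
inCentral Y0 = true
inCentral X1 = true
inCentral Y1 = true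
inCentral _  = false

centralCount : ∀ {n} → (Fin n → SV) → ℕ
centralCount {n} φ = length (filter (λ v → Data.Bool.T? (inCentral (φ v))) (allFin n))

Outside : ∀ {n} → (Fin n → SV) → Fin n → Set
Outside φ v = inX0Y0 (φ v) ≡ false

-- every component of G − φ⁻¹({X0,Y0}) has at most b vertices:
-- any list of distinct vertices lying in the component of a vertex v
-- has length at most b
ComponentsAtMost : ∀ {n} → Graph n → (Fin n → SV) → ℚ → Set
ComponentsAtMost G φ b =
  ∀ v (ws : List (Fin _)) → Outside φ v → Unique ws →
  All (ConnIn G (Outside φ) v) ws → ℕ→ℚ (length ws) Data.Rational.≤ b

-- Root T and put level x = ⌊|T_x| / M⌋, where T_x is the subtree below x and M = ⌊n/K⌋ with 1/K ≤ ξ.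
-- Call x a cut vertex when its level is positive and exceeds the levels of all its children. Cut vertices
-- of equal level have disjoint subtrees of size ≥ M, so there are at most (n/M + 1)(n/M) = O(K²) of them.
-- A piece of T minus the cut vertices with top vertex x has fewer than M vertices: either |T_x| < M, or some
-- cut vertex y below x has the level of x, and then the piece lies in T_x − T_y, where |T_x| − |T_y| < M.
-- The cut vertices form the hub, which goes to X0 or Y0 by depth parity. A piece is folded onto one arm of S
-- by parity (X2, Y1, Y3 or X1, Y2, X3), so all hub neighbours of the piece must have one parity; a cut child
-- of the wrong parity is dealt with by adding its parent to the hub. Only hub vertices and their neighbours
-- reach {X0, Y0, X1, Y1}: at most 2 · O(K²) · (Δ + 1) ≤ ξn vertices once Δ ≤ cn with c ≪ 1/K³.

module Submission where

open import Data.Bool using (Bool; true; false; T; T?; if_then_else_)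
open import Data.Empty using (⊥; ⊥-elim)
open import Data.Fin using (Fin; zero; suc)
open import Data.List using (List; []; _∷_; _∷ʳ_; length)
open import Data.List.Relation.Unary.All using (All; []; _∷_)
import Data.List.Relation.Unary.All as All
import Data.List.Relation.Unary.All.Properties as All
open import Data.List.Relation.Unary.Linked using (Linked; []; [-]; _∷_)
open import Data.List.Relation.Unary.Unique.Propositional using (Unique; []; _∷_)
open import Data.Nat using (ℕ; zero; suc; _+_; _∸_; _/_; _<_; NonZero; parity; s≤s⁻¹)
import Data.Nat.Properties
open import Algebra.Properties.Semiring.Sum Data.Nat.Properties.+-*-semiring using (sum; sum-syntax)
open import Data.Parity.Base using (Parity; 0ℙ; 1ℙ; _⁻¹)
open import Data.Product using (Σ; ∃-syntax; _×_; _,_; proj₁; proj₂)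
open import Data.Sum using (_⊎_; inj₁; inj₂)
open import Defs hiding (sym)
open import Function using (_∘_; _$_; id)
open import Level using (0ℓ)
open import Relation.Binary.PropositionalEquality
open import Relation.Nullary using (Dec; yes; no; does; ¬_; contradiction)
open import Relation.Nullary.Decidable using (_×-dec_; _⊎-dec_; _→-dec_; ¬?; dec-true; dec-false; decidable-stable)
open import Relation.Unary using (Pred; Decidable; _⊆_; _∪_; _∖_)
open import Relation.Unary.Properties using (_∪?_)

least : {P : Pred ℕ 0ℓ} → Decidable P → ∀ {k} → P k → ∃[ m ] P m × (∀ {j} → j < m → ¬ P j)
least P? {zero}  p₀ = zero , p₀ , λ ()
least P? {suc k} pₖ with P? zero
... | yes p₀ = zero , p₀ , λ ()
... | no ¬p₀ with least (P? ∘ suc) pₖ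
...   | m , pm , below = suc m , pm , λ { {zero} _ → ¬p₀ ; {suc j} j<m → below (s≤s⁻¹ j<m) }

Unique-∷ʳ⁺ : ∀ {A : Set} {xs : List A} {z} → Unique xs → All (_≢ z) xs → Unique (xs ∷ʳ z)
Unique-∷ʳ⁺ {xs = []}     []          []           = [] ∷ []
Unique-∷ʳ⁺ {xs = x ∷ xs} (x∉xs ∷ xs!) (x≢z ∷ xs≢z) = All.∷ʳ⁺ x∉xs x≢z ∷ Unique-∷ʳ⁺ xs! xs≢z

Linked-∷ʳ⁺ : ∀ {A : Set} {R : A → A → Set} xs {y z} → Linked R (xs ∷ʳ y) → R y z → Linked R (xs ∷ʳ y ∷ʳ z)
Linked-∷ʳ⁺ []            _             ryz = ryz ∷ [-]
Linked-∷ʳ⁺ (x ∷ [])      (rxy ∷ [-])   ryz = rxy ∷ ryz ∷ [-]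
Linked-∷ʳ⁺ (x ∷ x′ ∷ xs) (rxx′ ∷ rest) ryz = rxx′ ∷ Linked-∷ʳ⁺ (x′ ∷ xs) rest ryz

module Counting where

  open import Algebra.Properties.Semiring.Sum Data.Nat.Properties.+-*-semiring
    using (∑-comm; ∑-distrib-+; sum-cong-≗; sum-replicate-zero; *-distribʳ-sum)
  open import Data.Fin.Properties using (_≟_; any?)
  open import Data.List using (filter; allFin; tabulate)
  open import Data.Nat using (_*_; _≤_; z≤n; s≤s)
  open import Data.Nat.Properties hiding (_≟_)

  𝟙 : Bool → ℕ
  𝟙 true  = 1
  𝟙 false = 0

  count : ∀ {n} {P : Pred (Fin n) 0ℓ} → Decidable P → ℕ
  count {n} P? = ∑[ v < n ] 𝟙 (does (P? v))

  sum-mono-≤ : ∀ {n} {f g : Fin n → ℕ} → (∀ i → f i ≤ g i) → sum f ≤ sum g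
  sum-mono-≤ {zero}  f≤g = z≤n
  sum-mono-≤ {suc n} f≤g = +-mono-≤ (f≤g zero) (sum-mono-≤ (f≤g ∘ suc))

  term≤sum : ∀ {n} (f : Fin n → ℕ) i → f i ≤ sum f
  term≤sum f zero    = m≤m+n (f zero) _
  term≤sum f (suc i) = ≤-trans (term≤sum (f ∘ suc) i) (m≤n+m _ (f zero))

  sum-const : ∀ n c → ∑[ i < n ] c ≡ n * c
  sum-const zero    c = refl
  sum-const (suc n) c = cong (c +_) (sum-const n c)

  𝟙≤1 : ∀ b → 𝟙 b ≤ 1
  𝟙≤1 true  = ≤-refl
  𝟙≤1 false = z≤n

  𝟙-mono : ∀ {A B : Set} (A? : Dec A) (B? : Dec B) → (A → B) → 𝟙 (does A?) ≤ 𝟙 (does B?)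
  𝟙-mono (yes a) (yes _) _   = ≤-refl
  𝟙-mono (yes a) (no ¬b) a→b = contradiction (a→b a) ¬b
  𝟙-mono (no _)  _       _   = z≤n

  𝟙*-mono : ∀ {A : Set} (A? : Dec A) {x y} → (A → x ≤ y) → 𝟙 (does A?) * x ≤ 𝟙 (does A?) * y
  𝟙*-mono (yes a) x≤y = +-monoˡ-≤ 0 (x≤y a)
  𝟙*-mono (no _)  _   = z≤n

  count-｛｝ : ∀ {n} (u : Fin n) → count (u ≟_) ≡ 1
  count-｛｝ {suc n} zero    = cong suc (sum-replicate-zero n)
  count-｛｝ {suc n} (suc u) = count-｛｝ u

  module _ {n : ℕ} where

    _∖?_ : {P Q : Pred (Fin n) 0ℓ} → Decidable P → Decidable Q → Decidable (P ∖ Q)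
    (P? ∖? Q?) v = P? v ×-dec ¬? (Q? v)

    count-cong : {P Q : Pred (Fin n) 0ℓ} (P? : Decidable P) (Q? : Decidable Q) → P ⊆ Q → Q ⊆ P →
                 count P? ≡ count Q?
    count-cong P? Q? P⊆Q Q⊆P =
      sum-cong-≗ λ v → ≤-antisym (𝟙-mono (P? v) (Q? v) P⊆Q) (𝟙-mono (Q? v) (P? v) Q⊆P)

    count-mono : {P Q : Pred (Fin n) 0ℓ} (P? : Decidable P) (Q? : Decidable Q) → P ⊆ Q → count P? ≤ count Q?
    count-mono P? Q? P⊆Q = sum-mono-≤ λ v → 𝟙-mono (P? v) (Q? v) P⊆Q

    count-∅ : {P : Pred (Fin n) 0ℓ} (P? : Decidable P) → (∀ v → ¬ P v) → count P? ≡ 0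
    count-∅ P? ¬P = trans (sum-cong-≗ λ v → cong 𝟙 (dec-false (P? v) (¬P v))) (sum-replicate-zero n)

    count≤n : {P : Pred (Fin n) 0ℓ} (P? : Decidable P) → count P? ≤ n
    count≤n P? = begin
      count P?       ≤⟨ sum-mono-≤ (λ v → 𝟙≤1 (does (P? v))) ⟩
      ∑[ v < n ] 1   ≡⟨ trans (sum-const n 1) (*-identityʳ n) ⟩
      n              ∎
      where open ≤-Reasoning

    count-∖ : {P Q : Pred (Fin n) 0ℓ} (P? : Decidable P) (Q? : Decidable Q) → Q ⊆ P →
              count (P? ∖? Q?) + count Q? ≡ count P?
    count-∖ P? Q? Q⊆P = trans (sym (∑-distrib-+ (𝟙 ∘ does ∘ (P? ∖? Q?)) (𝟙 ∘ does ∘ Q?))) (sum-cong-≗ pointwise)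
      where
      pointwise : ∀ v → 𝟙 (does ((P? ∖? Q?) v)) + 𝟙 (does (Q? v)) ≡ 𝟙 (does (P? v))
      pointwise v with P? v | Q? v
      ... | yes _ | yes _ = refl
      ... | yes _ | no _  = refl
      ... | no ¬p | yes q = contradiction (Q⊆P q) ¬p
      ... | no _  | no _  = refl

    count-< : {P Q : Pred (Fin n) 0ℓ} (P? : Decidable P) (Q? : Decidable Q) → P ⊆ Q →
              ∀ {a} → Q a → ¬ P a → count P? < count Q?
    count-< {P} {Q} P? Q? P⊆Q {a} qa ¬pa = begin-strict
      count P?                             <⟨ n<1+n (count P?) ⟩
      suc (count P?)                       ≡⟨ +-comm 1 (count P?) ⟩
      count P? + 1                         ≤⟨ +-mono-≤ (count-mono P? (Q? ∖? (a ≟_)) P⊆Q∖a) (≤-reflexive (sym (count-｛｝ a))) ⟩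
      count (Q? ∖? (a ≟_)) + count (a ≟_)  ≡⟨ count-∖ Q? (a ≟_) (λ { refl → qa }) ⟩
      count Q?                             ∎
      where
      open ≤-Reasoning
      P⊆Q∖a : P ⊆ Q ∖ (a ≡_)
      P⊆Q∖a p = P⊆Q p , λ { refl → ¬pa p }

    count-∪ : {P Q : Pred (Fin n) 0ℓ} (P? : Decidable P) (Q? : Decidable Q) → count (P? ∪? Q?) ≤ count P? + count Q?
    count-∪ P? Q? = begin
      count (P? ∪? Q?)                                  ≤⟨ sum-mono-≤ pointwise ⟩
      ∑[ v < n ] (𝟙 (does (P? v)) + 𝟙 (does (Q? v)))   ≡⟨ ∑-distrib-+ (𝟙 ∘ does ∘ P?) (𝟙 ∘ does ∘ Q?) ⟩
      count P? + count Q?                               ∎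
      where
      open ≤-Reasoning
      pointwise : ∀ v → 𝟙 (does ((P? ∪? Q?) v)) ≤ 𝟙 (does (P? v)) + 𝟙 (does (Q? v))
      pointwise v with P? v | Q? v
      ... | yes _ | _     = s≤s z≤n
      ... | no _  | yes _ = ≤-refl
      ... | no _  | no _  = z≤n

    count≤1 : {P : Pred (Fin n) 0ℓ} (P? : Decidable P) → (∀ {v w} → P v → P w → v ≡ w) → count P? ≤ 1
    count≤1 P? unique with any? P?
    ... | yes (v , pv) = ≤-trans (count-mono P? (v ≟_) (unique pv)) (≤-reflexive (count-｛｝ v))
    ... | no ∄P        = ≤-trans (≤-reflexive (count-∅ P? (λ v pv → ∄P (v , pv)))) z≤n

    count-×ˡ : {A : Set} {S : Pred (Fin n) 0ℓ} (A? : Dec A) (S? : Decidable S) →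
               count (λ w → A? ×-dec S? w) ≡ 𝟙 (does A?) * count S?
    count-×ˡ (yes a) S? = trans (count-cong (λ w → yes a ×-dec S? w) S? proj₂ (a ,_)) (sym (+-identityʳ _))
    count-×ˡ (no ¬a) S? = count-∅ (λ w → no ¬a ×-dec S? w) (λ w → ¬a ∘ proj₁)

    length-filter-allFin : {P : Pred (Fin n) 0ℓ} (P? : Decidable P) → length (filter P? (allFin n)) ≡ count P?
    length-filter-allFin P? = length-filter-tabulate id
      where
      length-filter-tabulate : ∀ {m} (f : Fin m → Fin n) →
                               length (filter P? (tabulate f)) ≡ ∑[ i < m ] 𝟙 (does (P? (f i)))
      length-filter-tabulate {zero}  f = refl
      length-filter-tabulate {suc m} f with does (P? (f zero))
      ... | true  = cong suc (length-filter-tabulate (f ∘ suc))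
      ... | false = length-filter-tabulate (f ∘ suc)

    Unique⇒length≤count : {P : Pred (Fin n) 0ℓ} (P? : Decidable P) {ws : List (Fin n)} →
                           Unique ws → All P ws → length ws ≤ count P?
    Unique⇒length≤count P? []           []         = z≤n
    Unique⇒length≤count P? {w ∷ ws} (w∉ws ∷ ws!) (pw ∷ pws) = begin
      suc (length ws)                      ≤⟨ s≤s (Unique⇒length≤count (P? ∖? (w ≟_)) ws! (All.zip (pws , w∉ws))) ⟩
      suc (count (P? ∖? (w ≟_)))           ≡⟨ +-comm 1 _ ⟩
      count (P? ∖? (w ≟_)) + 1             ≡⟨ cong (count (P? ∖? (w ≟_)) +_) (count-｛｝ w) ⟨
      count (P? ∖? (w ≟_)) + count (w ≟_)  ≡⟨ count-∖ P? (w ≟_) (λ { refl → pw }) ⟩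
      count P?                             ∎
      where open ≤-Reasoning

  module _ {m n : ℕ} {R : Fin m → Pred (Fin n) 0ℓ} (R? : ∀ v → Decidable (R v)) where

    count≤∑count : {P : Pred (Fin n) 0ℓ} (P? : Decidable P) → (∀ {w} → P w → ∃[ v ] R v w) →
                   count P? ≤ ∑[ v < m ] count (R? v)
    count≤∑count P? covered = begin
      count P?                                 ≤⟨ sum-mono-≤ pointwise ⟩
      ∑[ w < n ] ∑[ v < m ] 𝟙 (does (R? v w))  ≡⟨ ∑-comm (λ w v → 𝟙 (does (R? v w))) ⟩
      ∑[ v < m ] count (R? v)                  ∎
      where
      open ≤-Reasoning
      pointwise : ∀ w → 𝟙 (does (P? w)) ≤ ∑[ v < m ] 𝟙 (does (R? v w))
      pointwise w with P? w
      ... | no _  = z≤n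
      ... | yes p with covered p
      ...   | v , rvw = ≤-trans (≤-reflexive (sym (cong 𝟙 (dec-true (R? v w) rvw))))
                                (term≤sum (λ v → 𝟙 (does (R? v w))) v)

    ∑count≤n : (∀ {v v′ w} → R v w → R v′ w → v ≡ v′) → ∑[ v < m ] count (R? v) ≤ n
    ∑count≤n disjoint = begin
      ∑[ v < m ] count (R? v)          ≡⟨ ∑-comm (λ v w → 𝟙 (does (R? v w))) ⟩
      ∑[ w < n ] count (λ v → R? v w)  ≤⟨ sum-mono-≤ (λ w → count≤1 (λ v → R? v w) disjoint) ⟩
      ∑[ w < n ] 1                     ≡⟨ trans (sum-const n 1) (*-identityʳ n) ⟩
      n                                ∎
      where open ≤-Reasoning

  module _ {m n : ℕ} {D : Pred (Fin m) 0ℓ} {S : Fin m → Pred (Fin n) 0ℓ}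
           (D? : Decidable D) (S? : ∀ v → Decidable (S v)) where

    private
      ∑-𝟙* : ∀ c → ∑[ v < m ] (𝟙 (does (D? v)) * c) ≡ count D? * c
      ∑-𝟙* c = sym (*-distribʳ-sum c (λ v → 𝟙 (does (D? v))))

      ∑-count-× : ∑[ v < m ] count (λ w → D? v ×-dec S? v w) ≡ ∑[ v < m ] (𝟙 (does (D? v)) * count (S? v))
      ∑-count-× = sum-cong-≗ (λ v → count-×ˡ (D? v) (S? v))

    ∑count-×≤ : ∀ {c} → (∀ {v} → D v → count (S? v) ≤ c) →
                ∑[ v < m ] count (λ w → D? v ×-dec S? v w) ≤ count D? * c
    ∑count-×≤ {c} bounded = begin
      ∑[ v < m ] count (λ w → D? v ×-dec S? v w)   ≡⟨ ∑-count-× ⟩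
      ∑[ v < m ] (𝟙 (does (D? v)) * count (S? v))  ≤⟨ sum-mono-≤ (λ v → 𝟙*-mono (D? v) bounded) ⟩
      ∑[ v < m ] (𝟙 (does (D? v)) * c)             ≡⟨ ∑-𝟙* c ⟩
      count D? * c                                 ∎
      where open ≤-Reasoning

    ≤∑count-× : ∀ {c} → (∀ {v} → D v → c ≤ count (S? v)) →
                count D? * c ≤ ∑[ v < m ] count (λ w → D? v ×-dec S? v w)
    ≤∑count-× {c} bounded = begin
      count D? * c                                 ≡⟨ ∑-𝟙* c ⟨
      ∑[ v < m ] (𝟙 (does (D? v)) * c)             ≤⟨ sum-mono-≤ (λ v → 𝟙*-mono (D? v) bounded) ⟩
      ∑[ v < m ] (𝟙 (does (D? v)) * count (S? v))  ≡⟨ ∑-count-× ⟨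
      ∑[ v < m ] count (λ w → D? v ×-dec S? v w)   ∎
      where open ≤-Reasoning

module RootedTree {n : ℕ} (G : Graph n) (tree : IsTree G) (r : Fin n) where

  import Data.Bool as Bool
  open import Data.Fin.Properties using (_≟_; any?)
  import Data.Nat as ℕ
  open import Data.Nat using (_≤_; z≤n; s≤s)
  open import Data.Nat.Properties hiding (_≟_)
  open import Data.Parity.Properties using (suc-homo-⁻¹; ⁻¹-selfInverse)
  open import Data.Unit using (⊤)
  open import Relation.Binary using (tri<; tri≈; tri>)

  infix 4 _~_ _⊑_

  _~_ : Fin n → Fin n → Set
  u ~ v = Adj G u v ≡ true

  ~-sym : ∀ {u v} → u ~ v → v ~ u
  ~-sym {u} {v} = trans (Graph.sym G v u)

  ~-irrefl : ∀ {u} → ¬ u ~ u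
  ~-irrefl {u} u~u with () ← trans (sym (Graph.irrefl G u)) u~u

  data Walk : ℕ → Fin n → Set where
    start : ∀ {k} → Walk k r
    _▸_   : ∀ {k u v} → Walk k u → u ~ v → Walk (suc k) v

  walk? : ∀ k → Decidable (Walk k)
  walk? k v with v ≟ r
  ... | yes refl = yes start
  walk? zero    v | no v≢r = no λ { start → v≢r refl }
  walk? (suc k) v | no v≢r with any? (λ u → walk? k u ×-dec (Adj G u v Bool.≟ true))
  ... | yes (u , w , e) = yes (w ▸ e)
  ... | no ∄u           = no λ { start → v≢r refl ; (w ▸ e) → ∄u (_ , w , e) }

  connected⇒walk : ∀ {v} → ConnIn G (λ _ → ⊤) r v → ∃[ k ] Walk k v
  connected⇒walk (here _)     = 0 , start
  connected⇒walk (step c e _) = let k , w = connected⇒walk c in suc k , w ▸ e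

  private
    shortest : ∀ v → ∃[ m ] Walk m v × (∀ {j} → j < m → ¬ Walk j v)
    shortest v = least (λ k → walk? k v) (proj₂ (connected⇒walk (proj₁ tree r v)))

  opaque
    depth : Fin n → ℕ
    depth v = proj₁ (shortest v)

    depth-walk : ∀ v → Walk (depth v) v
    depth-walk v = proj₁ (proj₂ (shortest v))

    depth-min : ∀ {k v} → Walk k v → depth v ≤ k
    depth-min {k} {v} w = ≮⇒≥ λ k<d → proj₂ (proj₂ (shortest v)) k<d w

  depth-~ : ∀ {u v} → u ~ v → depth v ≤ suc (depth u)
  depth-~ {u} u~v = depth-min (depth-walk u ▸ u~v)

  depth-root : depth r ≡ 0
  depth-root = n≤0⇒n≡0 (depth-min {0} start)

  depth≡0⇒root : ∀ {v} → depth v ≡ 0 → v ≡ r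
  depth≡0⇒root {v} d≡0 = walk₀ (subst (λ k → Walk k v) d≡0 (depth-walk v))
    where
    walk₀ : ∀ {v} → Walk 0 v → v ≡ r
    walk₀ start = refl

  depth-≢ : ∀ {u v} → depth u ≢ depth v → u ≢ v
  depth-≢ d≢ refl = d≢ refl

  depth≡suc⇒≢root : ∀ {v m} → depth v ≡ suc m → v ≢ r
  depth≡suc⇒≢root dv refl = 0≢1+n (trans (sym depth-root) dv)

  Predecessor : Fin n → Fin n → Set
  Predecessor u v = u ~ v × suc (depth u) ≡ depth v

  predecessor-exists : ∀ {v} → v ≢ r → ∃[ u ] Predecessor u v
  predecessor-exists {v} v≢r with depth v in d≡ | depth-walk v
  ... | zero  | _     = contradiction (depth≡0⇒root d≡) v≢r
  ... | suc k | start = contradiction refl v≢r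
  ... | suc k | w ▸ e = _ , e , sym (≤-antisym (subst (_≤ suc _) d≡ (depth-~ e)) (s≤s (depth-min w)))

  private
    predecessor? : ∀ v → Dec (∃[ u ] Predecessor u v)
    predecessor? v = any? λ u → (Adj G u v Bool.≟ true) ×-dec (suc (depth u) ℕ.≟ depth v)

  opaque
    parent : Fin n → Fin n
    parent v with predecessor? v
    ... | yes (u , _) = u
    ... | no _        = r

    parent-predecessor : ∀ {v} → v ≢ r → Predecessor (parent v) v
    parent-predecessor {v} v≢r with predecessor? v
    ... | yes (_ , p) = p
    ... | no ∄u       = contradiction (predecessor-exists v≢r) ∄u

    parent-root : parent r ≡ r
    parent-root with predecessor? r
    ... | yes (_ , _ , d≡) = contradiction (trans d≡ depth-root) (λ ())
    ... | no _             = refl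

  parent-~ : ∀ {v} → v ≢ r → parent v ~ v
  parent-~ = proj₁ ∘ parent-predecessor

  depth-parent : ∀ {v} → v ≢ r → depth v ≡ suc (depth (parent v))
  depth-parent = sym ∘ proj₂ ∘ parent-predecessor

  depth-parent-≡ : ∀ {v m} → depth v ≡ suc m → depth (parent v) ≡ m
  depth-parent-≡ dv = suc-injective (trans (sym (depth-parent (depth≡suc⇒≢root dv))) dv)

  private
    third : (S : Set) {A B C : Set} → S ≡ (A × B × C) → Set
    third _ {C = C} refl = C

  -- `IsCycle` states its closing edge by a recursion local to its definition; `third` names that condition.
  isCycle : ∀ v₀ v₁ ms y → Unique (v₀ ∷ v₁ ∷ ms ∷ʳ y) → Linked _~_ (v₀ ∷ v₁ ∷ ms ∷ʳ y) → y ~ v₀ →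
            IsCycle G (v₀ ∷ v₁ ∷ ms ∷ʳ y)
  isCycle v₀ v₁ []       y distinct path y~v₀ = distinct , path , y~v₀
  isCycle v₀ v₁ (m ∷ ms) y distinct path y~v₀ = distinct , path , closing m ms
    where
    closing : ∀ m ms → third (IsCycle G (v₀ ∷ v₁ ∷ m ∷ ms ∷ʳ y)) refl
    closing m []        = y~v₀
    closing m (m′ ∷ ms) = closing m′ ms

  shallower-∉ : ∀ {w m} zs → depth w ≡ m → All (λ z → suc m ≤ depth z) zs → All (w ≢_) zs
  shallower-∉ zs refl = All.map λ deeper → depth-≢ (<⇒≢ deeper)

  -- Replacing the ends of such a path by their parents gives a longer one a level higher,
  -- unless the parents coincide and close a cycle.
  no-level-path : ∀ m {x y} ms → depth x ≡ m → depth y ≡ m → x ≢ y →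
                  Unique (x ∷ ms ∷ʳ y) → Linked _~_ (x ∷ ms ∷ʳ y) → All (λ z → m ≤ depth z) (x ∷ ms ∷ʳ y) → ⊥
  no-level-path zero    ms dx dy x≢y _ _ _ = x≢y (trans (depth≡0⇒root dx) (sym (depth≡0⇒root dy)))
  no-level-path (suc m) {x} {y} ms dx dy x≢y distinct path deep with parent x ≟ parent y
  ... | yes px≡py = proj₂ tree _ (isCycle (parent x) x ms y (px∉ ∷ distinct) (parent-~ x≢r ∷ path) y~px)
    where
    x≢r : x ≢ r
    x≢r = depth≡suc⇒≢root dx
    px∉ : All (parent x ≢_) (x ∷ ms ∷ʳ y)
    px∉ = shallower-∉ (x ∷ ms ∷ʳ y) (depth-parent-≡ dx) deep
    y~px : y ~ parent x
    y~px = subst (y ~_) (sym px≡py) (~-sym (parent-~ (depth≡suc⇒≢root dy)))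
  ... | no px≢py = no-level-path m (x ∷ ms ∷ʳ y) dpx dpy px≢py distinct′ path′ deep′
    where
    dpx : depth (parent x) ≡ m
    dpx = depth-parent-≡ dx
    dpy : depth (parent y) ≡ m
    dpy = depth-parent-≡ dy
    distinct′ : Unique (parent x ∷ x ∷ ms ∷ʳ y ∷ʳ parent y)
    distinct′ = All.∷ʳ⁺ (shallower-∉ (x ∷ ms ∷ʳ y) dpx deep) px≢py
              ∷ Unique-∷ʳ⁺ distinct (All.map (λ py≢z → py≢z ∘ sym) (shallower-∉ (x ∷ ms ∷ʳ y) dpy deep))
    path′ : Linked _~_ (parent x ∷ x ∷ ms ∷ʳ y ∷ʳ parent y)
    path′ = parent-~ (depth≡suc⇒≢root dx) ∷ Linked-∷ʳ⁺ (x ∷ ms) path (~-sym (parent-~ (depth≡suc⇒≢root dy)))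
    deep′ : All (λ z → m ≤ depth z) (parent x ∷ x ∷ ms ∷ʳ y ∷ʳ parent y)
    deep′ = ≤-reflexive (sym dpx) ∷ All.∷ʳ⁺ (All.map (≤-trans (n≤1+n m)) deep) (≤-reflexive (sym dpy))

  IsChild : Fin n → Fin n → Set
  IsChild c p = c ≢ r × parent c ≡ p

  ~-deeper⇒child : ∀ {u v} → u ~ v → depth v ≡ suc (depth u) → IsChild v u
  ~-deeper⇒child {u} {v} u~v dv with parent v ≟ u
  ... | yes pv≡u = depth≡suc⇒≢root dv , pv≡u
  ... | no pv≢u  = ⊥-elim (no-level-path (depth u) (v ∷ []) refl dpv (pv≢u ∘ sym) distinct path deep)
    where
    dpv : depth (parent v) ≡ depth u
    dpv = depth-parent-≡ dv
    distinct : Unique (u ∷ v ∷ parent v ∷ [])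
    distinct = (depth-≢ (λ d≡ → 1+n≢n (sym (trans d≡ dv))) ∷ (pv≢u ∘ sym) ∷ [])
             ∷ (depth-≢ (λ d≡ → 1+n≢n (trans (sym dv) (trans d≡ dpv))) ∷ [])
             ∷ [] ∷ []
    path : Linked _~_ (u ∷ v ∷ parent v ∷ [])
    path = u~v ∷ ~-sym (parent-~ (depth≡suc⇒≢root dv)) ∷ [-]
    deep : All (λ z → depth u ≤ depth z) (u ∷ v ∷ parent v ∷ [])
    deep = ≤-refl ∷ ≤-trans (n≤1+n _) (≤-reflexive (sym dv)) ∷ ≤-reflexive (sym dpv) ∷ []

  ~⇒child : ∀ {u v} → u ~ v → IsChild v u ⊎ IsChild u v
  ~⇒child {u} {v} u~v with <-cmp (depth u) (depth v)
  ... | tri< du<dv _ _ = inj₁ (~-deeper⇒child u~v (≤-antisym (depth-~ u~v) du<dv))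
  ... | tri> _ _ dv<du = inj₂ (~-deeper⇒child (~-sym u~v) (≤-antisym (depth-~ (~-sym u~v)) dv<du))
  ... | tri≈ _ du≡dv _ = ⊥-elim $
      no-level-path (depth u) [] refl (sym du≡dv) u≢v ((u≢v ∷ []) ∷ [] ∷ []) (u~v ∷ [-]) (≤-refl ∷ ≤-reflexive du≡dv ∷ [])
    where
    u≢v : u ≢ v
    u≢v refl = ~-irrefl u~v

  parity-child : ∀ {c p} → IsChild c p → parity (depth c) ≡ parity (depth p) ⁻¹
  parity-child {c} {p} (c≢r , pc≡p) = begin
    parity (depth c)        ≡⟨ cong parity (trans (depth-parent c≢r) (cong (suc ∘ depth) pc≡p)) ⟩
    parity (suc (depth p))  ≡⟨ ⁻¹-selfInverse (suc-homo-⁻¹ (depth p)) ⟨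
    parity (depth p) ⁻¹     ∎
    where open ≡-Reasoning

  parity-~ : ∀ {u v} → u ~ v → parity (depth u) ≡ parity (depth v) ⁻¹
  parity-~ u~v with ~⇒child u~v
  ... | inj₁ v-child = sym (⁻¹-selfInverse (sym (parity-child v-child)))
  ... | inj₂ u-child = parity-child u-child

  ancestor : ℕ → Fin n → Fin n
  ancestor zero    v = v
  ancestor (suc k) v = ancestor k (parent v)

  depth-ancestor : ∀ k v → depth (ancestor k v) ≡ depth v ∸ k
  depth-ancestor zero    v = refl
  depth-ancestor (suc k) v = begin
    depth (ancestor k (parent v))  ≡⟨ depth-ancestor k (parent v) ⟩
    depth (parent v) ∸ k           ≡⟨ cong (_∸ k) depth-parent-∸1 ⟩
    depth v ∸ 1 ∸ k                ≡⟨ ∸-+-assoc (depth v) 1 k ⟩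
    depth v ∸ suc k                ∎
    where
    open ≡-Reasoning
    depth-parent-∸1 : depth (parent v) ≡ depth v ∸ 1
    depth-parent-∸1 with v ≟ r
    ... | yes refl = trans (cong depth parent-root) (trans depth-root (cong (_∸ 1) (sym depth-root)))
    ... | no v≢r   = cong (_∸ 1) (sym (depth-parent v≢r))

  ancestor-+ : ∀ a b v → ancestor (a + b) v ≡ ancestor a (ancestor b v)
  ancestor-+ a zero    v = cong (λ k → ancestor k v) (+-identityʳ a)
  ancestor-+ a (suc b) v = trans (cong (λ k → ancestor k v) (+-suc a b)) (ancestor-+ a b (parent v))

  _⊑_ : Fin n → Fin n → Set
  v ⊑ w = ancestor (depth v ∸ depth w) v ≡ w

  _⊑?_ : ∀ v w → Dec (v ⊑ w)
  v ⊑? w = ancestor (depth v ∸ depth w) v ≟ w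

  ⊑-depth : ∀ {v w} → v ⊑ w → depth w ≤ depth v
  ⊑-depth {v} {w} v⊑w = begin
    depth w                                 ≡⟨ cong depth v⊑w ⟨
    depth (ancestor (depth v ∸ depth w) v)  ≡⟨ depth-ancestor (depth v ∸ depth w) v ⟩
    depth v ∸ (depth v ∸ depth w)           ≤⟨ m∸n≤m (depth v) (depth v ∸ depth w) ⟩
    depth v                                 ∎
    where open ≤-Reasoning

  ⊑-ancestor : ∀ k v → k ≤ depth v → v ⊑ ancestor k v
  ⊑-ancestor k v k≤d rewrite depth-ancestor k v | m∸[m∸n]≡n k≤d = refl

  ⊑-refl : ∀ {v} → v ⊑ v
  ⊑-refl {v} = ⊑-ancestor 0 v z≤n

  ⊑-parent : ∀ {v} → v ≢ r → v ⊑ parent v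
  ⊑-parent {v} v≢r = ⊑-ancestor 1 v (n≢0⇒n>0 (v≢r ∘ depth≡0⇒root))

  child⇒⊑ : ∀ {c p} → IsChild c p → c ⊑ p
  child⇒⊑ (c≢r , refl) = ⊑-parent c≢r

  ⊑-same-depth : ∀ {v w} → v ⊑ w → depth v ≡ depth w → v ≡ w
  ⊑-same-depth {v} v⊑w d≡ = trans (cong (λ k → ancestor k v) (sym (m≤n⇒m∸n≡0 (≤-reflexive d≡)))) v⊑w

  ⊑-antisym : ∀ {v w} → v ⊑ w → w ⊑ v → v ≡ w
  ⊑-antisym v⊑w w⊑v = ⊑-same-depth v⊑w (≤-antisym (⊑-depth w⊑v) (⊑-depth v⊑w))

  ⊑-< : ∀ {v w} → v ⊑ w → v ≢ w → depth w < depth v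
  ⊑-< v⊑w v≢w = ≤∧≢⇒< (⊑-depth v⊑w) (λ d≡ → v≢w (⊑-same-depth v⊑w (sym d≡)))

  private
    ∸-split : ∀ {x y z} → x ≤ y → y ≤ z → z ∸ x ≡ (y ∸ x) + (z ∸ y)
    ∸-split {x} {y} {z} x≤y y≤z = begin
      z ∸ x              ≡⟨ cong (_∸ x) (m∸n+n≡m y≤z) ⟨
      (z ∸ y) + y ∸ x    ≡⟨ +-∸-assoc (z ∸ y) x≤y ⟩
      (z ∸ y) + (y ∸ x)  ≡⟨ +-comm (z ∸ y) (y ∸ x) ⟩
      (y ∸ x) + (z ∸ y)  ∎
      where open ≡-Reasoning

  ⊑-trans : ∀ {u v w} → u ⊑ v → v ⊑ w → u ⊑ w
  ⊑-trans {u} {v} {w} u⊑v v⊑w = begin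
    ancestor (depth u ∸ depth w) u                                  ≡⟨ cong (λ k → ancestor k u) (∸-split (⊑-depth v⊑w) (⊑-depth u⊑v)) ⟩
    ancestor ((depth v ∸ depth w) + (depth u ∸ depth v)) u          ≡⟨ ancestor-+ (depth v ∸ depth w) (depth u ∸ depth v) u ⟩
    ancestor (depth v ∸ depth w) (ancestor (depth u ∸ depth v) u)   ≡⟨ cong (ancestor (depth v ∸ depth w)) u⊑v ⟩
    ancestor (depth v ∸ depth w) v                                  ≡⟨ v⊑w ⟩
    w                                                               ∎
    where open ≡-Reasoning

  ⊑-linear : ∀ {v w w′} → v ⊑ w → v ⊑ w′ → depth w ≤ depth w′ → w′ ⊑ w
  ⊑-linear {v} {w} {w′} v⊑w v⊑w′ dw≤dw′ = begin
    ancestor (depth w′ ∸ depth w) w′                                  ≡⟨ cong (ancestor (depth w′ ∸ depth w)) v⊑w′ ⟨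
    ancestor (depth w′ ∸ depth w) (ancestor (depth v ∸ depth w′) v)   ≡⟨ ancestor-+ (depth w′ ∸ depth w) (depth v ∸ depth w′) v ⟨
    ancestor ((depth w′ ∸ depth w) + (depth v ∸ depth w′)) v          ≡⟨ cong (λ k → ancestor k v) (∸-split dw≤dw′ (⊑-depth v⊑w′)) ⟨
    ancestor (depth v ∸ depth w) v                                    ≡⟨ v⊑w ⟩
    w                                                                 ∎
    where open ≡-Reasoning

  ⊑-through-child : ∀ {v w} → v ⊑ w → v ≢ w → ∃[ c ] IsChild c w × v ⊑ c
  ⊑-through-child {v} {w} v⊑w v≢w with depth v ∸ depth w in k≡
  ... | zero  = ⊥-elim (v≢w v⊑w)
  ... | suc k = ancestor k v , (c≢r , ancestor-suc) , ⊑-ancestor k v (<⇒≤ k<dv)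
    where
    k<dv : k < depth v
    k<dv = ≤-trans (≤-reflexive (sym k≡)) (m∸n≤m (depth v) (depth w))
    c≢r : ancestor k v ≢ r
    c≢r c≡r = <⇒≢ (m<n⇒0<n∸m k<dv) (sym (trans (sym (depth-ancestor k v)) (trans (cong depth c≡r) depth-root)))
    ancestor-suc : parent (ancestor k v) ≡ w
    ancestor-suc = trans (sym (ancestor-+ 1 k v)) v⊑w

module Decomposition {n : ℕ} (G : Graph n) (tree : IsTree G) (r : Fin n) (M : ℕ) .{{_ : NonZero M}} where

  open import Data.Fin using (toℕ; fromℕ<)
  open import Data.Fin.Properties using (_≟_; all?; ¬∀⟶∃¬; toℕ-fromℕ<)
  import Data.Nat as ℕ
  open import Data.Nat using (_*_; _≤_; _≤?_; _<?_; s≤s)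
  open import Data.Nat.DivMod using (_%_; /-monoˡ-≤; m/n≡0⇒m<n; m/n≢0⇒n≤m; m/n*n≤m; m*n/n≡m; m≡m%n+[m/n]*n; m%n<n)
  open import Data.Nat.Induction using (<-wellFounded)
  open import Data.Nat.Properties hiding (_≟_)
  open import Induction.WellFounded using (Acc; acc)
  open Counting
  open RootedTree G tree r

  Subtree : Fin n → Pred (Fin n) 0ℓ
  Subtree x w = w ⊑ x

  subtree? : ∀ x → Decidable (Subtree x)
  subtree? x w = w ⊑? x

  size : Fin n → ℕ
  size x = count (subtree? x)

  size-mono : ∀ {v w} → v ⊑ w → size v ≤ size w
  size-mono v⊑w = count-mono (subtree? _) (subtree? _) (λ u⊑v → ⊑-trans u⊑v v⊑w)

  size-child : ∀ {c x} → IsChild c x → size c < size x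
  size-child {c} {x} (c≢r , refl) =
    count-< (subtree? c) (subtree? x) (λ u⊑c → ⊑-trans u⊑c (child⇒⊑ (c≢r , refl))) ⊑-refl
      (λ x⊑c → 1+n≰n (subst (_≤ depth (parent c)) (depth-parent c≢r) (⊑-depth x⊑c)))

  level : Fin n → ℕ
  level x = size x / M

  level-mono : ∀ {v w} → v ⊑ w → level v ≤ level w
  level-mono v⊑w = /-monoˡ-≤ M (size-mono v⊑w)

  isChild? : ∀ c x → Dec (IsChild c x)
  isChild? c x = ¬? (c ≟ r) ×-dec (parent c ≟ x)

  Cut : Pred (Fin n) 0ℓ
  Cut x = 1 ≤ level x × (∀ c → IsChild c x → level c < level x)

  opaque
    cut? : Decidable Cut
    cut? x = (1 ≤? level x) ×-dec all? (λ c → isChild? c x →-dec (level c <? level x))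

  ¬cut⇒heavy-child : ∀ {x} → ¬ Cut x → 1 ≤ level x → ∃[ c ] IsChild c x × level c ≡ level x
  ¬cut⇒heavy-child {x} ¬cut 1≤level
    with ¬∀⟶∃¬ n _ (λ c → isChild? c x →-dec (level c <? level x)) (λ lighter → ¬cut (1≤level , lighter))
  ... | c , ¬lighter with isChild? c x
  ...   | yes c-child = c , c-child , ≤-antisym (level-mono (child⇒⊑ c-child)) (≮⇒≥ (λ lt → ¬lighter (λ _ → lt)))
  ...   | no ¬c-child = ⊥-elim (¬lighter (λ c-child → contradiction c-child ¬c-child))

  cut-below : ∀ {x} → ¬ Cut x → 1 ≤ level x → ∃[ y ] Cut y × y ⊑ x × level y ≡ level x
  cut-below {x} = go (<-wellFounded (size x))
    where
    go : ∀ {x} → Acc _<_ (size x) → ¬ Cut x → 1 ≤ level x → ∃[ y ] Cut y × y ⊑ x × level y ≡ level x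
    go (acc smaller) ¬cut 1≤level with ¬cut⇒heavy-child ¬cut 1≤level
    ... | c , c-child , level≡ with cut? c
    ...   | yes cut-c = c , cut-c , child⇒⊑ c-child , level≡
    ...   | no ¬cut-c with go (smaller (size-child c-child)) ¬cut-c (subst (1 ≤_) (sym level≡) 1≤level)
    ...     | y , cut-y , y⊑c , level-y≡ = y , cut-y , ⊑-trans y⊑c (child⇒⊑ c-child) , trans level-y≡ level≡

  -- top z: climb from z as long as the parent is not a cut vertex; depth z steps reach the root.
  private
    topWithin : ℕ → Fin n → Fin n
    topWithin zero    z = z
    topWithin (suc k) z = if does (cut? (parent z)) then z else topWithin k (parent z)

  top : Fin n → Fin n
  top z = topWithin (depth z) z

  top-step : ∀ {z} → z ≢ r → top z ≡ (if does (cut? (parent z)) then z else top (parent z))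
  top-step {z} z≢r = cong (λ k → topWithin k z) (depth-parent z≢r)

  top-cut-parent : ∀ {z} → z ≢ r → Cut (parent z) → top z ≡ z
  top-cut-parent {z} z≢r cut-pz =
    trans (top-step z≢r) (cong (if_then z else top (parent z)) (dec-true (cut? (parent z)) cut-pz))

  top-parent : ∀ {z} → z ≢ r → ¬ Cut (parent z) → top z ≡ top (parent z)
  top-parent {z} z≢r ¬cut-pz =
    trans (top-step z≢r) (cong (if_then z else top (parent z)) (dec-false (cut? (parent z)) ¬cut-pz))

  ⊑-top : ∀ z → z ⊑ top z
  ⊑-top z = go (depth z) refl
    where
    go : ∀ {z} k → depth z ≡ k → z ⊑ topWithin k z
    go zero    _  = ⊑-refl
    go {z} (suc k) dz with cut? (parent z)
    ... | yes _ = ⊑-refl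
    ... | no _  = ⊑-trans (⊑-parent (depth≡suc⇒≢root dz)) (go k (depth-parent-≡ dz))

  ¬cut-below-top : ∀ {z y} → ¬ Cut z → z ⊑ y → y ⊑ top z → ¬ Cut y
  ¬cut-below-top {z} = go (depth z) refl
    where
    go : ∀ {z y} k → depth z ≡ k → ¬ Cut z → z ⊑ y → y ⊑ topWithin k z → ¬ Cut y
    go zero _ ¬cut-z z⊑y y⊑z = subst (¬_ ∘ Cut) (⊑-antisym z⊑y y⊑z) ¬cut-z
    go {z} {y} (suc k) dz ¬cut-z z⊑y y⊑top with cut? (parent z) | y ≟ z
    ... | yes _      | _        = subst (¬_ ∘ Cut) (⊑-antisym z⊑y y⊑top) ¬cut-z
    ... | no _       | yes refl = ¬cut-z
    ... | no ¬cut-pz | no y≢z   = go k (depth-parent-≡ dz) ¬cut-pz pz⊑y y⊑top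
      where
      z≢r : z ≢ r
      z≢r = depth≡suc⇒≢root dz
      pz⊑y : parent z ⊑ y
      pz⊑y = ⊑-linear z⊑y (⊑-parent z≢r)
               (s≤s⁻¹ (≤-trans (⊑-< z⊑y (λ z≡y → y≢z (sym z≡y))) (≤-reflexive (depth-parent z≢r))))

  ¬cut-top : ∀ {z} → ¬ Cut z → ¬ Cut (top z)
  ¬cut-top ¬cut-z = ¬cut-below-top ¬cut-z (⊑-top _) ⊑-refl

  Piece : Fin n → Pred (Fin n) 0ℓ
  Piece x w = ¬ Cut w × top w ≡ x

  piece? : ∀ x → Decidable (Piece x)
  piece? x w = ¬? (cut? w) ×-dec (top w ≟ x)

  piece⊆subtree : ∀ x → Piece x ⊆ Subtree x
  piece⊆subtree x {w} (_ , top-w≡x) = subst (w ⊑_) top-w≡x (⊑-top w)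

  size<M+level*M : ∀ x → size x < M + level x * M
  size<M+level*M x = begin-strict
    size x                         ≡⟨ m≡m%n+[m/n]*n (size x) M ⟩
    size x % M + level x * M       <⟨ +-monoˡ-< (level x * M) (m%n<n (size x) M) ⟩
    M + level x * M                ∎
    where open ≤-Reasoning

  piece-small : ∀ {x} → ¬ Cut x → count (piece? x) < M
  piece-small {x} ¬cut-x with level x ℕ.≟ 0
  ... | yes level≡0 = ≤-<-trans (count-mono (piece? x) (subtree? x) (piece⊆subtree x)) (m/n≡0⇒m<n level≡0)
  ... | no level≢0 with cut-below ¬cut-x (n≢0⇒n>0 level≢0)
  ...   | y , cut-y , y⊑x , level-y≡ = +-cancelʳ-< (level x * M) (count (piece? x)) M $ begin-strict
    count (piece? x) + level x * M               ≤⟨ +-mono-≤ (count-mono (piece? x) (subtree? x ∖? subtree? y) piece⊆x∖y) level*M≤size-y ⟩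
    count (subtree? x ∖? subtree? y) + size y    ≡⟨ count-∖ (subtree? x) (subtree? y) (λ w⊑y → ⊑-trans w⊑y y⊑x) ⟩
    size x                                       <⟨ size<M+level*M x ⟩
    M + level x * M                              ∎
    where
    open ≤-Reasoning
    level*M≤size-y : level x * M ≤ size y
    level*M≤size-y = subst (λ l → l * M ≤ size y) level-y≡ (m/n*n≤m (size y) M)
    piece⊆x∖y : Piece x ⊆ Subtree x ∖ Subtree y
    piece⊆x∖y {w} (¬cut-w , top-w≡x) =
      piece⊆subtree x (¬cut-w , top-w≡x) , λ w⊑y → ¬cut-below-top ¬cut-w w⊑y (subst (y ⊑_) (sym top-w≡x) y⊑x) cut-y

  M≤size : ∀ {v} → Cut v → M ≤ size v
  M≤size (1≤level , _) = m/n≢0⇒n≤m (λ level≡0 → 1+n≰n (subst (1 ≤_) level≡0 1≤level))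

  below-cut-same-level⇒≡ : ∀ {v v′} → Cut v → level v′ ≡ level v → v′ ⊑ v → v′ ≡ v
  below-cut-same-level⇒≡ {v} {v′} cut-v level≡ v′⊑v with v′ ≟ v
  ... | yes v′≡v = v′≡v
  ... | no v′≢v with ⊑-through-child v′⊑v v′≢v
  ...   | c , c-child , v′⊑c = ⊥-elim (<-irrefl level≡ (≤-<-trans (level-mono v′⊑c) (proj₂ cut-v c c-child)))

  CutAt : ℕ → Pred (Fin n) 0ℓ
  CutAt j v = Cut v × level v ≡ j

  cutAt? : ∀ j → Decidable (CutAt j)
  cutAt? j v = cut? v ×-dec (level v ℕ.≟ j)

  cutAt-disjoint : ∀ {j v v′ w} → CutAt j v × w ⊑ v → CutAt j v′ × w ⊑ v′ → v ≡ v′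
  cutAt-disjoint {v = v} {v′} ((cut-v , refl) , w⊑v) ((cut-v′ , level-v′) , w⊑v′) with ≤-total (depth v) (depth v′)
  ... | inj₁ dv≤dv′ = sym (below-cut-same-level⇒≡ cut-v level-v′ (⊑-linear w⊑v w⊑v′ dv≤dv′))
  ... | inj₂ dv′≤dv = below-cut-same-level⇒≡ cut-v′ (sym level-v′) (⊑-linear w⊑v′ w⊑v dv′≤dv)

  count-cutAt : ∀ j → count (cutAt? j) ≤ n / M
  count-cutAt j = begin
    count (cutAt? j)                    ≡⟨ m*n/n≡m (count (cutAt? j)) M ⟨
    count (cutAt? j) * M / M            ≤⟨ /-monoˡ-≤ M packed ⟩
    n / M                               ∎
    where
    open ≤-Reasoning
    packed : count (cutAt? j) * M ≤ n
    packed = ≤-trans (≤∑count-× (cutAt? j) subtree? (M≤size ∘ proj₁))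
                     (∑count≤n (λ v w → cutAt? j v ×-dec subtree? v w) cutAt-disjoint)

  count-cut : count cut? ≤ suc (n / M) * (n / M)
  count-cut = begin
    count cut?                                        ≤⟨ count≤∑count (λ j → cutAt? (toℕ j)) cut? by-level ⟩
    ∑[ j < suc (n / M) ] count (cutAt? (toℕ j))       ≤⟨ sum-mono-≤ {suc (n / M)} (λ j → count-cutAt (toℕ j)) ⟩
    ∑[ j < suc (n / M) ] (n / M)                      ≡⟨ sum-const (suc (n / M)) (n / M) ⟩
    suc (n / M) * (n / M)                             ∎
    where
    open ≤-Reasoning
    by-level : ∀ {v} → Cut v → ∃[ j ] CutAt (toℕ j) v
    by-level {v} cut-v = fromℕ< level<J+1 , cut-v , sym (toℕ-fromℕ< level<J+1)
      where
      level<J+1 : level v < suc (n / M)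
      level<J+1 = s≤s (/-monoˡ-≤ M (count≤n (subtree? v)))

⁻¹≢⇒≡ : ∀ {p q : Parity} → p ⁻¹ ≢ q → p ≡ q
⁻¹≢⇒≡ {0ℙ} {0ℙ} _ = refl
⁻¹≢⇒≡ {0ℙ} {1ℙ} ≢ = contradiction refl ≢
⁻¹≢⇒≡ {1ℙ} {0ℙ} ≢ = contradiction refl ≢
⁻¹≢⇒≡ {1ℙ} {1ℙ} _ = refl

-- place h s p a: the image of a vertex of depth parity p that lies in the hub (h), belongs to a piece whose
-- hub neighbours have parity s, and is adjacent to the hub (a).
place : Bool → Parity → Parity → Bool → SV
place true  _  0ℙ _     = X0
place true  _  1ℙ _     = Y0
place false 0ℙ 0ℙ _     = X2
place false 0ℙ 1ℙ true  = Y1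
place false 0ℙ 1ℙ false = Y3
place false 1ℙ 0ℙ true  = X1
place false 1ℙ 0ℙ false = X3
place false 1ℙ 1ℙ _     = Y2

place-hub-hub : ∀ {s s′ p p′ a a′} → p′ ≡ p ⁻¹ → SAdj (place true s p a) (place true s′ p′ a′) ≡ true
place-hub-hub {p = 0ℙ} refl = refl
place-hub-hub {p = 1ℙ} refl = refl

place-hub-rim : ∀ {s s′ p p′ a a′} → p′ ≡ p ⁻¹ → s′ ≡ p → a′ ≡ true →
                SAdj (place true s p a) (place false s′ p′ a′) ≡ true
place-hub-rim {p = 0ℙ} refl refl refl = refl
place-hub-rim {p = 1ℙ} refl refl refl = refl

place-rim-rim : ∀ {s s′ p p′ a a′} → p′ ≡ p ⁻¹ → s′ ≡ s → SAdj (place false s p a) (place false s′ p′ a′) ≡ true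
place-rim-rim {0ℙ} {p = 0ℙ} {a′ = true}  refl refl = refl
place-rim-rim {0ℙ} {p = 0ℙ} {a′ = false} refl refl = refl
place-rim-rim {0ℙ} {p = 1ℙ} {a = true}   refl refl = refl
place-rim-rim {0ℙ} {p = 1ℙ} {a = false}  refl refl = refl
place-rim-rim {1ℙ} {p = 0ℙ} {a = true}   refl refl = refl
place-rim-rim {1ℙ} {p = 0ℙ} {a = false}  refl refl = refl
place-rim-rim {1ℙ} {p = 1ℙ} {a′ = true}  refl refl = refl
place-rim-rim {1ℙ} {p = 1ℙ} {a′ = false} refl refl = refl

place-rim-hub : ∀ {s s′ p p′ a a′} → p′ ≡ p ⁻¹ → s ≡ p′ → a ≡ true →
                SAdj (place false s p a) (place true s′ p′ a′) ≡ true
place-rim-hub {p = 0ℙ} refl refl refl = refl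
place-rim-hub {p = 1ℙ} refl refl refl = refl

inX0Y0-place : ∀ h s p a → inX0Y0 (place h s p a) ≡ h
inX0Y0-place true  _  0ℙ _     = refl
inX0Y0-place true  _  1ℙ _     = refl
inX0Y0-place false 0ℙ 0ℙ _     = refl
inX0Y0-place false 0ℙ 1ℙ true  = refl
inX0Y0-place false 0ℙ 1ℙ false = refl
inX0Y0-place false 1ℙ 0ℙ true  = refl
inX0Y0-place false 1ℙ 0ℙ false = refl
inX0Y0-place false 1ℙ 1ℙ _     = refl

inCentral-place-far : ∀ s p → inCentral (place false s p false) ≡ false
inCentral-place-far 0ℙ 0ℙ = refl
inCentral-place-far 0ℙ 1ℙ = refl
inCentral-place-far 1ℙ 0ℙ = refl
inCentral-place-far 1ℙ 1ℙ = refl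

module Homomorphism {n : ℕ} (G : Graph n) (tree : IsTree G) (r : Fin n) (M : ℕ) .{{_ : NonZero M}} where

  import Data.Bool as Bool
  open import Data.Bool.Properties using (T-≡)
  open import Data.Fin.Properties using (_≟_; any?)
  open import Data.Nat using (_*_; _≤_; s≤s)
  open import Data.Nat.Properties hiding (_≟_)
  import Data.Parity.Properties as ℙ
  open import Function.Bundles using (Equivalence)
  open Counting
  open RootedTree G tree r
  open Decomposition G tree r M

  -- The parity required of the hub neighbours of the piece of z: that of the parent of its top vertex.
  side : Fin n → Parity
  side z = parity (depth (top z)) ⁻¹

  Misaligned : Pred (Fin n) 0ℓ
  Misaligned y = Cut y × y ≢ r × parity (depth y) ≢ side (parent y)

  misaligned? : Decidable Misaligned
  misaligned? y = cut? y ×-dec ¬? (y ≟ r) ×-dec ¬? (parity (depth y) ℙ.≟ side (parent y))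

  Extra : Pred (Fin n) 0ℓ
  Extra f = ∃[ y ] Misaligned y × parent y ≡ f

  Hub : Pred (Fin n) 0ℓ
  Hub = Cut ∪ Extra

  NearHub : Pred (Fin n) 0ℓ
  NearHub v = ∃[ u ] v ~ u × Hub u

  opaque
    extra? : Decidable Extra
    extra? f = any? λ y → misaligned? y ×-dec (parent y ≟ f)

    hub? : Decidable Hub
    hub? = cut? ∪? extra?

    nearHub? : Decidable NearHub
    nearHub? v = any? λ u → (Adj G v u Bool.≟ true) ×-dec hub? u

  extra-parity : ∀ {u} → Extra u → parity (depth u) ≡ side u
  extra-parity (y , (_ , y≢r , misaligned) , refl) =
    ⁻¹≢⇒≡ (λ p⁻¹≡side → misaligned (trans (parity-child (y≢r , refl)) p⁻¹≡side))

  top-~ : ∀ {z u} → z ~ u → ¬ Cut z → ¬ Cut u → top z ≡ top u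
  top-~ z~u ¬cut-z ¬cut-u with ~⇒child z~u
  ... | inj₁ (u≢r , refl) = sym (top-parent u≢r ¬cut-z)
  ... | inj₂ (z≢r , refl) = top-parent z≢r ¬cut-u

  cut-parity : ∀ {z u} → ¬ Hub z → Cut u → z ~ u → parity (depth u) ≡ side z
  cut-parity {z} {u} ¬hub-z cut-u z~u with ~⇒child z~u
  ... | inj₁ (u≢r , refl) = decidable-stable (parity (depth u) ℙ.≟ side z)
                              (λ misaligned → ¬hub-z (inj₂ (u , (cut-u , u≢r , misaligned) , refl)))
  ... | inj₂ (z≢r , refl) = begin
    parity (depth (parent z))  ≡⟨ ℙ.⁻¹-selfInverse (sym (parity-child (z≢r , refl))) ⟨
    parity (depth z) ⁻¹        ≡⟨ cong (_⁻¹ ∘ parity ∘ depth) (top-cut-parent z≢r cut-u) ⟨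
    side z                     ∎
    where open ≡-Reasoning

  hub-parity : ∀ {z u} → ¬ Hub z → Hub u → z ~ u → parity (depth u) ≡ side z
  hub-parity ¬hub-z (inj₁ cut-u) z~u = cut-parity ¬hub-z cut-u z~u
  hub-parity {u = u} ¬hub-z (inj₂ extra-u) z~u with cut? u
  ... | yes cut-u = cut-parity ¬hub-z cut-u z~u
  ... | no ¬cut-u = trans (extra-parity extra-u)
                          (cong (_⁻¹ ∘ parity ∘ depth) (top-~ (~-sym z~u) ¬cut-u (¬hub-z ∘ inj₁)))

  φ : Fin n → SV
  φ v = place (does (hub? v)) (side v) (parity (depth v)) (does (nearHub? v))

  does-nearHub : ∀ {v u} → v ~ u → Hub u → does (nearHub? v) ≡ true
  does-nearHub v~u hub-u = dec-true (nearHub? _) (_ , v~u , hub-u)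

  φ-hom : IsHom G φ
  φ-hom u v u~v with hub? u | hub? v
  ... | yes _     | yes _     = place-hub-hub (parity-~ (~-sym u~v))
  ... | yes hub-u | no ¬hub-v = place-hub-rim (parity-~ (~-sym u~v)) (sym (hub-parity ¬hub-v hub-u (~-sym u~v)))
                                              (does-nearHub (~-sym u~v) hub-u)
  ... | no ¬hub-u | yes hub-v = place-rim-hub (parity-~ (~-sym u~v)) (sym (hub-parity ¬hub-u hub-v u~v))
                                              (does-nearHub u~v hub-v)
  ... | no ¬hub-u | no ¬hub-v = place-rim-rim (parity-~ (~-sym u~v))
                                              (cong (_⁻¹ ∘ parity ∘ depth) (sym (top-~ u~v (¬hub-u ∘ inj₁) (¬hub-v ∘ inj₁))))

  outside⇒¬hub : ∀ {v} → Outside φ v → ¬ Hub v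
  outside⇒¬hub {v} outside hub-v with () ← trans (sym outside) (trans (inX0Y0-place _ _ _ _) (dec-true (hub? v) hub-v))

  walk⇒piece : ∀ {v w} → ConnIn G (Outside φ) v w → Piece (top v) w
  walk⇒piece (here outside)            = outside⇒¬hub outside ∘ inj₁ , refl
  walk⇒piece {w = w} (step walk u~w outside-w) with walk⇒piece walk
  ... | ¬cut-u , top-u≡ = ¬cut-w , trans (sym (top-~ u~w ¬cut-u ¬cut-w)) top-u≡
    where
    ¬cut-w : ¬ Cut w
    ¬cut-w = outside⇒¬hub outside-w ∘ inj₁

  component-small : ∀ v (ws : List (Fin n)) → Outside φ v → Unique ws → All (ConnIn G (Outside φ) v) ws → length ws < M
  component-small v ws outside distinct walks =
    ≤-<-trans (Unique⇒length≤count (piece? (top v)) distinct (All.map walk⇒piece walks))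
              (piece-small (¬cut-top (outside⇒¬hub outside ∘ inj₁)))

  ClosedNbhd : Fin n → Pred (Fin n) 0ℓ
  ClosedNbhd u v = u ≡ v ⊎ T (Adj G u v)

  closedNbhd? : ∀ u → Decidable (ClosedNbhd u)
  closedNbhd? u v = (u ≟ v) ⊎-dec T? (Adj G u v)

  count-closedNbhd : ∀ u → count (closedNbhd? u) ≤ suc (deg G u)
  count-closedNbhd u = begin
    count (closedNbhd? u)                ≤⟨ count-∪ (u ≟_) (T? ∘ Adj G u) ⟩
    count (u ≟_) + count (T? ∘ Adj G u)  ≡⟨ cong₂ _+_ (count-｛｝ u) (sym (length-filter-allFin (T? ∘ Adj G u))) ⟩
    suc (deg G u)                        ∎
    where open ≤-Reasoning

  central⇒near-hub : ∀ {v} → T (inCentral (φ v)) → ∃[ u ] Hub u × ClosedNbhd u v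
  central⇒near-hub {v} central with hub? v | nearHub? v
  ... | yes hub-v | _                      = v , hub-v , inj₁ refl
  ... | no _      | yes (u , v~u , hub-u)  = u , hub-u , inj₂ (Equivalence.from T-≡ (~-sym v~u))
  ... | no _      | no _                   = ⊥-elim (subst T (inCentral-place-far _ _) central)

  count-extra : count extra? ≤ count cut?
  count-extra = begin
    count extra?                                                       ≤⟨ count≤∑count misaligned-child? extra? id ⟩
    ∑[ y < n ] count (misaligned-child? y)                                    ≤⟨ ∑count-×≤ misaligned? (λ y → parent y ≟_) (λ {y} _ → ≤-reflexive (count-｛｝ (parent y))) ⟩
    count misaligned? * 1                                              ≡⟨ *-identityʳ _ ⟩
    count misaligned?                                                  ≤⟨ count-mono misaligned? cut? proj₁ ⟩
    count cut?                                                         ∎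
    where
    open ≤-Reasoning
    misaligned-child? : ∀ y → Decidable (λ f → Misaligned y × parent y ≡ f)
    misaligned-child? y f = misaligned? y ×-dec (parent y ≟ f)

  opaque
    unfolding hub?

    count-hub : count hub? ≤ count cut? + count cut?
    count-hub = ≤-trans (count-∪ cut? extra?) (+-monoʳ-≤ (count cut?) count-extra)

  count-central : ∀ {Δ} → (∀ u → deg G u ≤ Δ) → centralCount φ ≤ (count cut? + count cut?) * suc Δ
  count-central {Δ} deg≤Δ = begin
    centralCount φ                                      ≡⟨ length-filter-allFin (T? ∘ inCentral ∘ φ) ⟩
    count (T? ∘ inCentral ∘ φ)                          ≤⟨ count≤∑count (λ u v → hub? u ×-dec closedNbhd? u v) (T? ∘ inCentral ∘ φ) central⇒near-hub ⟩
    ∑[ u < n ] count (λ v → hub? u ×-dec closedNbhd? u v)   ≤⟨ ∑count-×≤ hub? closedNbhd? (λ {u} _ → ≤-trans (count-closedNbhd u) (s≤s (deg≤Δ u))) ⟩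
    count hub? * suc Δ                                  ≤⟨ *-monoˡ-≤ (suc Δ) count-hub ⟩
    (count cut? + count cut?) * suc Δ                   ∎
    where open ≤-Reasoning


module Existence where

  open import Data.Nat using (_*_; _≤_; _%_; >-nonZero)
  open import Data.Nat.DivMod using (m/n*n≤m; m≡m%n+[m/n]*n; m%n<n; m≥n⇒m/n>0; m<n*o⇒m/o<n; /-monoˡ-≤; m*n/n≡m)
  open import Data.Nat.Properties
  open import Data.Nat.Solver using (module +-*-Solver)
  open +-*-Solver

  tree-hom : ∀ {n} (G : Graph n) → IsTree G → Fin n → ∀ M .{{_ : NonZero M}} →
    Σ (Fin n → SV) λ φ → IsHom G φ
      × (∀ v ws → Outside φ v → Unique ws → All (ConnIn G (Outside φ) v) ws → length ws < M)
      × (∀ Δ → (∀ u → deg G u ≤ Δ) → centralCount φ ≤ (suc (n / M) * (n / M) + suc (n / M) * (n / M)) * suc Δ)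
  tree-hom G tree r M = φ , φ-hom , component-small , λ Δ deg≤Δ →
    ≤-trans (count-central deg≤Δ) (*-monoˡ-≤ (suc Δ) (+-mono-≤ count-cut count-cut))
    where
    open Decomposition G tree r M using (count-cut)
    open Homomorphism G tree r M

  cubeBound : ℕ → ℕ
  cubeBound K = 16 * (K * (K * K))

  K≤cubeBound : ∀ K .{{_ : NonZero K}} → K ≤ cubeBound K
  K≤cubeBound K@(suc _) = ≤-trans (m≤m*n K (K * K)) (m≤n*m (K * (K * K)) 16)

  n/[n/K]<2K : ∀ n K .{{_ : NonZero K}} .{{_ : NonZero (n / K)}} → n / (n / K) < 2 * K
  n/[n/K]<2K n K = m<n*o⇒m/o<n $ begin-strict
    n                          ≡⟨ m≡m%n+[m/n]*n n K ⟩
    n % K + n / K * K          <⟨ +-monoˡ-< (n / K * K) (<-≤-trans (m%n<n n K) (m≤n*m K (n / K))) ⟩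
    n / K * K + n / K * K      ≡⟨ solve 2 (λ M K → M :* K :+ M :* K := con 2 :* K :* M) refl (n / K) K ⟩
    2 * K * (n / K)            ∎
    where open ≤-Reasoning

  central-arithmetic : ∀ {K n Δ J X} → J < 2 * K → X ≤ (suc J * J + suc J * J) * suc Δ →
                       Δ * suc (cubeBound K) ≤ n → cubeBound K ≤ n → X * K ≤ n
  central-arithmetic {K} {n} {Δ} {J} {X} J<2K X≤ Δ≤ B≤n = *-cancelˡ-≤ 2 $ begin
    2 * (X * K)                                            ≤⟨ *-monoʳ-≤ 2 (*-monoˡ-≤ K (≤-trans X≤ (*-monoˡ-≤ (suc Δ) (+-mono-≤ J²≤4K² J²≤4K²)))) ⟩
    2 * ((2 * K * (2 * K) + 2 * K * (2 * K)) * suc Δ * K)  ≡⟨ solve 2 (λ K Δ → con 2 :* ((con 2 :* K :* (con 2 :* K) :+ con 2 :* K :* (con 2 :* K)) :* (con 1 :+ Δ) :* K)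
                                                              := con 16 :* (K :* (K :* K)) :+ Δ :* (con 16 :* (K :* (K :* K)))) refl K Δ ⟩
    cubeBound K + Δ * cubeBound K                          ≤⟨ +-mono-≤ B≤n (≤-trans (*-monoʳ-≤ Δ (n≤1+n (cubeBound K))) Δ≤) ⟩
    n + n                                                  ≡⟨ cong (_+_ n) (+-identityʳ n) ⟨
    2 * n                                                  ∎
    where
    open ≤-Reasoning
    J²≤4K² : suc J * J ≤ 2 * K * (2 * K)
    J²≤4K² = *-mono-≤ J<2K (<⇒≤ J<2K)

  *≤⇒≤/ : ∀ {a n} d .{{_ : NonZero d}} → a * d ≤ n → a ≤ n / d
  *≤⇒≤/ {a} {n} d a*d≤n = ≤-trans (≤-reflexive (sym (m*n/n≡m a d))) (/-monoˡ-≤ d a*d≤n)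

  <n/d⇒*≤ : ∀ {a n} d .{{_ : NonZero d}} → a < n / d → a * d ≤ n
  <n/d⇒*≤ {a} {n} d a<n/d = ≤-trans (*-monoˡ-≤ d (<⇒≤ a<n/d)) (m/n*n≤m n d)

  tree-hom-scaled : ∀ K .{{_ : NonZero K}} {n} (G : Graph n) → IsTree G → Fin n → cubeBound K < n →
    Σ (Fin n → SV) λ φ → IsHom G φ
      × (∀ v ws → Outside φ v → Unique ws → All (ConnIn G (Outside φ) v) ws → length ws * K ≤ n)
      × ((∀ u → deg G u * suc (cubeBound K) ≤ n) → centralCount φ * K ≤ n)
  tree-hom-scaled K {n} G tree r B<n =
    let φ , hom , small , central = tree-hom G tree r M
    in φ , hom , (λ v ws outside distinct walks → <n/d⇒*≤ K (small v ws outside distinct walks))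
               , (λ deg≤ → central-arithmetic (n/[n/K]<2K n K) (central Δ (λ u → *≤⇒≤/ (suc (cubeBound K)) (deg≤ u)))
                                              (m/n*n≤m n (suc (cubeBound K))) (<⇒≤ B<n))
    where
    M : ℕ
    M = n / K
    instance
      M≢0 : NonZero M
      M≢0 = >-nonZero (m≥n⇒m/n>0 (≤-trans (K≤cubeBound K) (<⇒≤ B<n)))
    Δ : ℕ
    Δ = n / suc (cubeBound K)

module RationalBounds where

  import Data.Integer as ℤ
  open import Data.Integer using (+_; +≤+)
  open import Data.Integer.Properties using (pos-*; drop‿+≤+)
  open import Data.Nat using (_*_; _≤_)
  open import Data.Nat.Coprimality using (Coprime; 1-coprimeTo)
  import Data.Nat.Coprimality as Coprimality
  open import Data.Nat.Properties using (≤-trans; m≤n*m; *-identityˡ; *-identityʳ)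
  open import Data.Rational using (mkℚ; toℚᵘ)
  import Data.Rational as ℚ
  open import Data.Rational.Properties using (normalize-coprime; toℚᵘ-mono-≤; toℚᵘ-cancel-≤; toℚᵘ-homo-*)
  open import Data.Rational.Unnormalised using (mkℚᵘ; *≤*; _≃_)
  import Data.Rational.Unnormalised as ℚᵘ
  open import Data.Rational.Unnormalised.Properties using (≤-respʳ-≃; ≃-sym; ≃-trans; ≃-reflexive; drop-*≤*)
  open import Function.Bundles using (_⇔_; mk⇔; Equivalence)

  toℚᵘ-ℕ→ℚ : ∀ a → toℚᵘ (ℕ→ℚ a) ≡ mkℚᵘ (+ a) 0
  toℚᵘ-ℕ→ℚ a = cong toℚᵘ (normalize-coprime (Coprimality.sym (1-coprimeTo a)))

  toℚᵘ-frac*ℕ→ℚ : ∀ P k .(c : Coprime P (suc k)) m → toℚᵘ (mkℚ (+ P) k c ℚ.* ℕ→ℚ m) ≃ mkℚᵘ (+ (P * m)) k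
  toℚᵘ-frac*ℕ→ℚ P k c m = ≃-trans (toℚᵘ-homo-* (mkℚ (+ P) k c) (ℕ→ℚ m)) $ ≃-reflexive $
    trans (cong (mkℚᵘ (+ P) k ℚᵘ.*_) (toℚᵘ-ℕ→ℚ m)) (cong₂ mkℚᵘ (sym (pos-* P m)) (*-identityʳ k))

  mkℚᵘ-≤⇔ : ∀ a b k → (mkℚᵘ (+ a) 0 ℚᵘ.≤ mkℚᵘ (+ b) k) ⇔ (a * suc k ≤ b)
  mkℚᵘ-≤⇔ a b k = mk⇔
    (λ a≤b → subst (a * suc k ≤_) (*-identityʳ b) (drop‿+≤+ (subst₂ ℤ._≤_ (sym (pos-* a (suc k))) (sym (pos-* b 1)) (drop-*≤* a≤b))))
    (λ a≤b → *≤* (subst₂ ℤ._≤_ (pos-* a (suc k)) (pos-* b 1) (+≤+ (subst (a * suc k ≤_) (sym (*-identityʳ b)) a≤b))))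

  ℕ→ℚ≤frac*ℕ→ℚ⇔ : ∀ P k .(c : Coprime P (suc k)) a m → (ℕ→ℚ a ℚ.≤ mkℚ (+ P) k c ℚ.* ℕ→ℚ m) ⇔ (a * suc k ≤ P * m)
  ℕ→ℚ≤frac*ℕ→ℚ⇔ P k c a m = mk⇔
    (λ a≤qm → Equivalence.to (mkℚᵘ-≤⇔ a (P * m) k)
       (≤-respʳ-≃ (toℚᵘ-frac*ℕ→ℚ P k c m) (subst (ℚᵘ._≤ _) (toℚᵘ-ℕ→ℚ a) (toℚᵘ-mono-≤ a≤qm))))
    (λ a≤Pm → toℚᵘ-cancel-≤
       (≤-respʳ-≃ (≃-sym (toℚᵘ-frac*ℕ→ℚ P k c m)) (subst (ℚᵘ._≤ _) (sym (toℚᵘ-ℕ→ℚ a)) (Equivalence.from (mkℚᵘ-≤⇔ a (P * m) k) a≤Pm))))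

  ℕ→ℚ≤ξ* : ∀ {p k} .(c : Coprime (suc p) (suc k)) a n → a * suc k ≤ n → ℕ→ℚ a ℚ.≤ mkℚ (+ suc p) k c ℚ.* ℕ→ℚ n
  ℕ→ℚ≤ξ* {p} {k} c a n a*K≤n = Equivalence.from (ℕ→ℚ≤frac*ℕ→ℚ⇔ (suc p) k c a n) (≤-trans a*K≤n (m≤n*m n (suc p)))

  ≤frac*ℕ→ℚ⇒* : ∀ B a n → ℕ→ℚ a ℚ.≤ mkℚ (+ 1) B (1-coprimeTo (suc B)) ℚ.* ℕ→ℚ n → a * suc B ≤ n
  ≤frac*ℕ→ℚ⇒* B a n a≤n/B = subst (a * suc B ≤_) (*-identityˡ n) (Equivalence.to (ℕ→ℚ≤frac*ℕ→ℚ⇔ 1 B _ a n) a≤n/B)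

open import Data.Integer using (+_; +[1+_])
open import Data.Nat.Coprimality using (1-coprimeTo)
open import Data.Rational using (ℚ; Positive; mkℚ; _≤_; _*_)
open Existence using (cubeBound; tree-hom-scaled)
open RationalBounds using (ℕ→ℚ≤ξ*; ≤frac*ℕ→ℚ⇒*)

lemma4p1 : (ξ : ℚ) → Positive ξ →
    Σ ℚ λ c → Positive c × Σ ℕ λ n₀ →
      (n : ℕ) → n₀ Data.Nat.≤ n → (Tr : Graph n) → IsTree Tr →
      (∀ u → ℕ→ℚ (deg Tr u) ≤ c * ℕ→ℚ n) →
      Σ (Fin n → SV) λ φ → IsHom Tr φ ×
        ComponentsAtMost Tr φ (ξ * ℕ→ℚ n) ×
        ℕ→ℚ (centralCount φ) ≤ ξ * ℕ→ℚ n
-- The clauses for the numerators 0 and -[1+ _] are absurd, as Positive ξ is then empty.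
lemma4p1 (mkℚ +[1+ p ] k coprime) _ = c , _ , suc B , homomorphism
  where
  B : ℕ
  B = cubeBound (suc k)
  c : ℚ
  c = mkℚ (+ 1) B (1-coprimeTo (suc B))
  homomorphism : (n : ℕ) → suc B Data.Nat.≤ n → (Tr : Graph n) → IsTree Tr → (∀ u → ℕ→ℚ (deg Tr u) ≤ c * ℕ→ℚ n) →
                 Σ (Fin n → SV) λ φ → IsHom Tr φ × ComponentsAtMost Tr φ (mkℚ +[1+ p ] k coprime * ℕ→ℚ n)
                                      × ℕ→ℚ (centralCount φ) ≤ mkℚ +[1+ p ] k coprime * ℕ→ℚ n
  homomorphism (suc n) B<n Tr tree deg≤cn =
    let φ , hom , small , central = tree-hom-scaled (suc k) Tr tree zero B<n
    in φ , hom , (λ v ws outside distinct walks → ℕ→ℚ≤ξ* coprime (length ws) (suc n) (small v ws outside distinct walks))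
             , ℕ→ℚ≤ξ* coprime (centralCount φ) (suc n) (central (λ u → ≤frac*ℕ→ℚ⇒* B (deg Tr u) (suc n) (deg≤cn u)))
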